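{- Let $\{\overrightarrow{AB},\overrightarrow{CD}\}$ be a pair of prime segments such that $A,B,C,D$ are in convex position (i.e. they are exactly the vertices of $\mathrm{Conv}(\{A,B,C,D\})$). Then the pair is proper if and only if $AB$, $BC$, $CD$, $DA$ are edges of $\mathrm{Conv}(\{A,B,C,D\})$ and the orientation of $\overrightarrow{ABCD}$ is counterclockwise.
   Context: Two integer points are adjacent if the segment joining them contains no other integer point; such a segment is called prime. $\mathcal{G}_{m,n}=\{0,\dots,m-1\}\times\{0,\dots,n-1\}$. For distinct points $A,B,C$ the oriented triangle $\overrightarrow{ABC}$ is counterclockwise if the determinant with rows $(a_1,a_2,1),(b_1,b_2,1),(c_1,c_2,1)$ is positive; an oriented convex quadrilateral $\overrightarrow{ABCD}$ is counterclockwise if $\overrightarrow{ABC},\overrightarrow{BCD},\overrightarrow{CDA},\overrightarrow{DAB}$ are counterclockwise. For adjacent $A,B\in\mathcal{G}_{m,n}$, $f_{\overrightarrow{AB}}:\mathcal{G}_{m,n}\to\{0,1\}$ has $f(A)=1$, $f(B)=0$; for $X$ on the line $\ell(AB)$, $f(X)=1$ iff $d(A,X)<d(B,X)$; for $X\notin\ell(AB)$, $f(X)=1$ iff $\overrightarrow{ABX}$ is counterclockwise. A pair $\{\overrightarrow{AB},\overrightarrow{CD}\}$ is proper if both segments are prime and $f_{\overrightarrow{CD}}(A)=f_{\overrightarrow{CD}}(B)=f_{\overrightarrow{AB}}(C)=f_{\overrightarrow{AB}}(D)=1$. -}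

module Defs where

open import Data.Nat using (ℕ)
open import Data.Integer using (ℤ; +_; _+_; _-_; _*_; _≤_; _<_; _<?_; _≟_)
open import Data.Product using (_×_; _,_; proj₁; proj₂; ∃; ∃-syntax; Σ)
open import Data.Sum using (_⊎_)
open import Data.Bool using (Bool; true; false; if_then_else_)
open import Data.List using (List; []; _∷_)
open import Data.List.Relation.Unary.All using (All)
open import Relation.Nullary using (¬_)
open import Relation.Nullary.Decidable using (⌊_⌋)
open import Relation.Binary.PropositionalEquality using (_≡_; _≢_)

Point : Set
Point = ℤ × ℤ

x₁ x₂ : Point → ℤ
x₁ = proj₁
x₂ = proj₂

InGrid : ℕ → ℕ → Point → Set
InGrid m n P = (+ 0 ≤ x₁ P × x₁ P < + m) × (+ 0 ≤ x₂ P × x₂ P < + n)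

-- Determinant with rows (a1,a2,1),(b1,b2,1),(c1,c2,1) (cofactor expansion along the last column).
det : Point → Point → Point → ℤ
det A B C =
  (x₁ B * x₂ C - x₂ B * x₁ C) - (x₁ A * x₂ C - x₂ A * x₁ C) + (x₁ A * x₂ B - x₂ A * x₁ B)

CCW : Point → Point → Point → Set
CCW A B C = + 0 < det A B C

CCWQuad : Point → Point → Point → Point → Set
CCWQuad A B C D = CCW A B C × CCW B C D × CCW C D A × CCW D A B

_·_ : ℕ → Point → Point
k · P = (+ k * x₁ P , + k * x₂ P)

_⊕_ : Point → Point → Point
P ⊕ Q = (x₁ P + x₁ Q , x₂ P + x₂ Q)

-- X lies on the closed segment AB: X is a convex combination of A and B
-- (nonnegative rational coefficients, cleared of denominators).
OnSegment : Point → Point → Point → Set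
OnSegment A B X =
  Σ ℕ λ w₁ → Σ ℕ λ w₂ → (Data.Nat._+_ w₁ w₂ ≢ 0) × ((w₁ · A) ⊕ (w₂ · B) ≡ (Data.Nat._+_ w₁ w₂) · X)

Adjacent : Point → Point → Set
Adjacent A B = A ≢ B × (∀ (X : Point) → OnSegment A B X → X ≡ A ⊎ X ≡ B)

PrimeSeg : Point → Point → Set
PrimeSeg = Adjacent

-- Squared Euclidean distance (comparing squares is the same as comparing distances).
dist² : Point → Point → ℤ
dist² P Q = (x₁ P - x₁ Q) * (x₁ P - x₁ Q) + (x₂ P - x₂ Q) * (x₂ P - x₂ Q)

f : Point → Point → Point → Bool
f A B X =
  if ⌊ det A B X ≟ + 0 ⌋
  then ⌊ dist² A X <? dist² B X ⌋
  else ⌊ + 0 <? det A B X ⌋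

Proper : Point → Point → Point → Point → Set
Proper A B C D =
  PrimeSeg A B × PrimeSeg C D ×
  f C D A ≡ true × f C D B ≡ true × f A B C ≡ true × f A B D ≡ true

lin : ℤ → ℤ → Point → ℤ
lin a b P = a * x₁ P + b * x₂ P

-- X is a vertex of Conv(S): some supporting line a x + b y = c meets Conv(S) exactly in X,
-- i.e. every P ∈ S satisfies a p₁ + b p₂ ≤ c, with equality iff P = X.
IsVertex : List Point → Point → Set
IsVertex S X = ∃[ a ] ∃[ b ] ∃[ c ]
  (lin a b X ≡ c ×
   All (λ P → lin a b P ≤ c × (lin a b P ≡ c → P ≡ X)) S)

-- XY is an edge of Conv(S): X ≠ Y, and some supporting line meets Conv(S) exactly in the
-- segment XY, i.e. every P ∈ S satisfies a p₁ + b p₂ ≤ c, with equality iff P ∈ {X, Y}.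
IsEdge : List Point → Point → Point → Set
IsEdge S X Y = X ≢ Y × (∃[ a ] ∃[ b ] ∃[ c ]
  (lin a b X ≡ c × lin a b Y ≡ c ×
   All (λ P → lin a b P ≤ c × (lin a b P ≡ c → P ≡ X ⊎ P ≡ Y)) S))

-- A, B, C, D are in convex position: each of them is a vertex of Conv{A,B,C,D}
-- (the vertex set of the hull of a finite set is always contained in the set).
ConvexPosition : Point → Point → Point → Point → Set
ConvexPosition A B C D =
  IsVertex (A ∷ B ∷ C ∷ D ∷ []) A × IsVertex (A ∷ B ∷ C ∷ D ∷ []) B ×
  IsVertex (A ∷ B ∷ C ∷ D ∷ []) C × IsVertex (A ∷ B ∷ C ∷ D ∷ []) D

-- Convex position makes every three of A, B, C, D non-collinear: three collinear points
-- cannot each be the strict maximiser, among the three, of some linear functional, yet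
-- every vertex of a hull is one. Off the line ℓ(XY) the value f X Y Z just records the
-- sign of det X Y Z, so properness says that C, D lie strictly left of AB and A, B
-- strictly left of CD. This is exactly the counterclockwise orientation of ABCD, and the
-- four sides are then edges of the hull, supported by the lines through them.
module Submission where

open import Defs
open import Data.Nat using (ℕ; z≤n)
open import Data.Integer
  using (ℤ; +_; +[1+_]; -[1+_]; _+_; _-_; _*_; -_; _≤_; _<_; _<?_; _≟_; +≤+)
open import Data.Integer.Base using (positive; nonNegative)
open import Data.Integer.Properties
open import Data.Integer.Tactic.RingSolver using (solve-∀)
open import Data.Bool using (true; false; if_then_else_)
open import Data.Product using (_×_; _,_; Σ)
open import Data.Sum using (_⊎_; inj₁; inj₂)
open import Data.List using (List; []; _∷_)
open import Data.List.Relation.Unary.All as All using (All; []; _∷_)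
open import Data.List.Relation.Unary.Any using (here; there)
open import Data.List.Membership.Propositional using (_∈_)
open import Level using (Level)
open import Function.Base using (_∘_)
open import Function.Bundles using (_⇔_; mk⇔)
open import Relation.Nullary using (Dec; yes; no; ¬_; contradiction)
open import Relation.Nullary.Decidable using (⌊_⌋)
open import Relation.Binary.PropositionalEquality

private
  variable
    ℓ : Level
    Φ : Set ℓ
    P Q R X Y : Point
    S : List Point


*-pos : ∀ {i j} → + 0 < i → + 0 < j → + 0 < i * j
*-pos {i} {j} 0<i 0<j = subst (_< i * j) (*-zeroʳ i) (*-monoˡ-<-pos i ⦃ positive 0<i ⦄ 0<j)

*-cancelˡ-pos : ∀ {i j} → + 0 < i → + 0 < i * j → + 0 < j
*-cancelˡ-pos {i} {j} 0<i 0<ij =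
  *-cancelˡ-<-nonNeg i ⦃ nonNegative (<⇒≤ 0<i) ⦄ (subst (_< i * j) (sym (*-zeroʳ i)) 0<ij)

i<j⇒0<j-i : ∀ {i j} → i < j → + 0 < j - i
i<j⇒0<j-i {i} {j} i<j = subst (_< j - i) (+-inverseʳ i) (+-monoˡ-< (- i) i<j)

i-j<i : ∀ i {j} → + 0 < j → i - j < i
i-j<i i 0<j = subst (i + _ <_) (+-identityʳ i) (+-monoʳ-< i (neg-mono-< 0<j))

square-nonNeg : ∀ i → + 0 ≤ i * i
square-nonNeg (+ 0) = +≤+ z≤n
square-nonNeg +[1+ n ] = +≤+ z≤n
square-nonNeg -[1+ n ] = +≤+ z≤n

drop-multiple-of-0 : ∀ {i j k l} → i ≡ j + k * l → l ≡ + 0 → i ≡ j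
drop-multiple-of-0 {j = j} {k} i≡j+kl refl =
  trans i≡j+kl (trans (cong (_+_ j) (*-zeroʳ k)) (+-identityʳ j))

⌊⌋≡true : (p? : Dec Φ) → Φ → ⌊ p? ⌋ ≡ true
⌊⌋≡true (yes _) _ = refl
⌊⌋≡true (no ¬p) p = contradiction p ¬p

⌊⌋≡false : (p? : Dec Φ) → ¬ Φ → ⌊ p? ⌋ ≡ false
⌊⌋≡false (yes p) ¬p = contradiction p ¬p
⌊⌋≡false (no _) _ = refl

⌊⌋≡true⇒ : (p? : Dec Φ) → ⌊ p? ⌋ ≡ true → Φ
⌊⌋≡true⇒ (yes p) _ = p


det-rotate : ∀ P Q R → det P Q R ≡ det Q R P
det-rotate (p₁ , p₂) (q₁ , q₂) (r₁ , r₂) = identity p₁ p₂ q₁ q₂ r₁ r₂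
  where
  identity : ∀ p₁ p₂ q₁ q₂ r₁ r₂ →
    (q₁ * r₂ - q₂ * r₁) - (p₁ * r₂ - p₂ * r₁) + (p₁ * q₂ - p₂ * q₁)
    ≡ (r₁ * p₂ - r₂ * p₁) - (q₁ * p₂ - q₂ * p₁) + (q₁ * r₂ - q₂ * r₁)
  identity = solve-∀

det-swap : ∀ P Q R → det P R Q ≡ - det P Q R
det-swap (p₁ , p₂) (q₁ , q₂) (r₁ , r₂) = identity p₁ p₂ q₁ q₂ r₁ r₂
  where
  identity : ∀ p₁ p₂ q₁ q₂ r₁ r₂ →
    (r₁ * q₂ - r₂ * q₁) - (p₁ * q₂ - p₂ * q₁) + (p₁ * r₂ - p₂ * r₁)
    ≡ - ((q₁ * r₂ - q₂ * r₁) - (p₁ * r₂ - p₂ * r₁) + (p₁ * q₂ - p₂ * q₁))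
  identity = solve-∀

det-repeat : ∀ P Q → det P Q Q ≡ + 0
det-repeat (p₁ , p₂) (q₁ , q₂) = identity p₁ p₂ q₁ q₂
  where
  identity : ∀ p₁ p₂ q₁ q₂ →
    (q₁ * q₂ - q₂ * q₁) - (p₁ * q₂ - p₂ * q₁) + (p₁ * q₂ - p₂ * q₁) ≡ + 0
  identity = solve-∀

ccw⇒≢ : ∀ X Y Z → CCW X Y Z → X ≢ Y
ccw⇒≢ X Y Z 0<det refl = <-irrefl (sym degenerate) 0<det
  where
  degenerate : det X X Z ≡ + 0
  degenerate = trans (det-rotate X X Z) (trans (det-rotate X Z X) (det-repeat Z X))


-- The two sides differ by a 2 × 2 minor of g and h evaluated on Q − P and R − P, which is a
-- multiple of det P Q R.
collinear-cross : ∀ P Q R g₁ g₂ h₁ h₂ → det P Q R ≡ + 0 →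
  let g = lin g₁ g₂; h = lin h₁ h₂ in
  (g P - g Q) * (h R - h P) ≡ (g P - g R) * (h Q - h P)
collinear-cross (p₁ , p₂) (q₁ , q₂) (r₁ , r₂) g₁ g₂ h₁ h₂ =
  drop-multiple-of-0 {k = g₂ * h₁ - g₁ * h₂} (identity p₁ p₂ q₁ q₂ r₁ r₂ g₁ g₂ h₁ h₂)
  where
  identity : ∀ p₁ p₂ q₁ q₂ r₁ r₂ g₁ g₂ h₁ h₂ →
    ((g₁ * p₁ + g₂ * p₂) - (g₁ * q₁ + g₂ * q₂)) * ((h₁ * r₁ + h₂ * r₂) - (h₁ * p₁ + h₂ * p₂))
    ≡ ((g₁ * p₁ + g₂ * p₂) - (g₁ * r₁ + g₂ * r₂)) * ((h₁ * q₁ + h₂ * q₂) - (h₁ * p₁ + h₂ * p₂))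
      + (g₂ * h₁ - g₁ * h₂) * ((q₁ * r₂ - q₂ * r₁) - (p₁ * r₂ - p₂ * r₁) + (p₁ * q₂ - p₂ * q₁))
  identity = solve-∀

collinear-sum : ∀ P Q R h₁ h₂ k₁ k₂ → det P Q R ≡ + 0 →
  let h = lin h₁ h₂; k = lin k₁ k₂ in
  (h Q - h R) * (k R - k P) + (h R - h P) * (k R - k Q) ≡ + 0
collinear-sum (p₁ , p₂) (q₁ , q₂) (r₁ , r₂) h₁ h₂ k₁ k₂ =
  drop-multiple-of-0 {k = h₁ * k₂ - h₂ * k₁} (identity p₁ p₂ q₁ q₂ r₁ r₂ h₁ h₂ k₁ k₂)
  where
  identity : ∀ p₁ p₂ q₁ q₂ r₁ r₂ h₁ h₂ k₁ k₂ →
    ((h₁ * q₁ + h₂ * q₂) - (h₁ * r₁ + h₂ * r₂)) * ((k₁ * r₁ + k₂ * r₂) - (k₁ * p₁ + k₂ * p₂))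
    + ((h₁ * r₁ + h₂ * r₂) - (h₁ * p₁ + h₂ * p₂)) * ((k₁ * r₁ + k₂ * r₂) - (k₁ * q₁ + k₂ * q₂))
    ≡ + 0 + (h₁ * k₂ - h₂ * k₁) * ((q₁ * r₂ - q₂ * r₁) - (p₁ * r₂ - p₂ * r₁) + (p₁ * q₂ - p₂ * q₁))
  identity = solve-∀

Extreme : Point → Point → Point → Set
Extreme X Q R = Σ ℤ λ a → Σ ℤ λ b → lin a b Q < lin a b X × lin a b R < lin a b X

extremes⇒noncollinear : Extreme P Q R → Extreme Q P R → Extreme R P Q → det P Q R ≢ + 0
-- On a line the increments of a and b are proportional, so b increases from P to R; then
-- both summands of collinear-sum are positive.
extremes⇒noncollinear {P} {Q} {R}
  (a₁ , a₂ , aQ<aP , aR<aP) (b₁ , b₂ , bP<bQ , bR<bQ) (c₁ , c₂ , cP<cR , cQ<cR) collinear =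
  <-irrefl (sym (collinear-sum P Q R b₁ b₂ c₁ c₂ collinear))
    (+-mono-< (*-pos (i<j⇒0<j-i bR<bQ) (i<j⇒0<j-i cP<cR))
              (*-pos 0<bR-bP (i<j⇒0<j-i cQ<cR)))
  where
  0<bR-bP : + 0 < lin b₁ b₂ R - lin b₁ b₂ P
  0<bR-bP = *-cancelˡ-pos (i<j⇒0<j-i aQ<aP)
    (subst (+ 0 <_) (sym (collinear-cross P Q R a₁ a₂ b₁ b₂ collinear))
      (*-pos (i<j⇒0<j-i aR<aP) (i<j⇒0<j-i bP<bQ)))

vertex⇒extreme : IsVertex S X → Q ∈ S → R ∈ S → Q ≢ X → R ≢ X → Extreme X Q R
vertex⇒extreme {S} {X} (a , b , c , aX≡c , supporting) Q∈S R∈S Q≢X R≢X =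
  a , b , below Q∈S Q≢X , below R∈S R≢X
  where
  below : ∀ {P} → P ∈ S → P ≢ X → lin a b P < lin a b X
  below {P} P∈S P≢X with All.lookup supporting P∈S
  ... | aP≤c , aP≡c⇒P≡X =
    ≤∧≢⇒< (subst (lin a b P ≤_) (sym aX≡c) aP≤c) (λ aP≡aX → P≢X (aP≡c⇒P≡X (trans aP≡aX aX≡c)))

convex⇒noncollinear : All (IsVertex S) S → P ∈ S → Q ∈ S → R ∈ S →
  P ≢ Q → Q ≢ R → P ≢ R → det P Q R ≢ + 0
convex⇒noncollinear vertices P∈S Q∈S R∈S P≢Q Q≢R P≢R = extremes⇒noncollinear
  (vertex⇒extreme (All.lookup vertices P∈S) Q∈S R∈S (≢-sym P≢Q) (≢-sym P≢R))
  (vertex⇒extreme (All.lookup vertices Q∈S) P∈S R∈S P≢Q (≢-sym Q≢R))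
  (vertex⇒extreme (All.lookup vertices R∈S) P∈S Q∈S P≢R Q≢R)


f-off-line : ∀ X Y Z → det X Y Z ≢ + 0 → f X Y Z ≡ ⌊ + 0 <? det X Y Z ⌋
f-off-line X Y Z d≢0 =
  cong (λ b → if b then ⌊ dist² X Z <? dist² Y Z ⌋ else ⌊ + 0 <? det X Y Z ⌋)
       (⌊⌋≡false (det X Y Z ≟ + 0) d≢0)

f≡true⇒ccw : ∀ X Y Z → det X Y Z ≢ + 0 → f X Y Z ≡ true → CCW X Y Z
f≡true⇒ccw X Y Z d≢0 fXYZ = ⌊⌋≡true⇒ (+ 0 <? det X Y Z) (trans (sym (f-off-line X Y Z d≢0)) fXYZ)

ccw⇒f≡true : ∀ X Y Z → CCW X Y Z → f X Y Z ≡ true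
ccw⇒f≡true X Y Z 0<d = trans (f-off-line X Y Z (≢-sym (<⇒≢ 0<d))) (⌊⌋≡true (+ 0 <? det X Y Z) 0<d)

ccw⇒reversed-f≡false : ∀ X Y Z → CCW X Y Z → f X Z Y ≡ false
ccw⇒reversed-f≡false X Y Z 0<d =
  trans (f-off-line X Z Y (<⇒≢ reversed<0)) (⌊⌋≡false (+ 0 <? det X Z Y) (<-asym reversed<0))
  where
  reversed<0 : det X Z Y < + 0
  reversed<0 = subst (_< + 0) (sym (det-swap X Y Z)) (neg-mono-< 0<d)

dist²-self : ∀ P → dist² P P ≡ + 0
dist²-self P rewrite +-inverseʳ (x₁ P) | +-inverseʳ (x₂ P) = refl

dist²-nonNeg : ∀ P Q → + 0 ≤ dist² P Q
dist²-nonNeg P Q = +-mono-≤ (square-nonNeg (x₁ P - x₁ Q)) (square-nonNeg (x₂ P - x₂ Q))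

f-at-head : ∀ X Y → f X Y Y ≡ false
f-at-head X Y = begin
  f X Y Y
    ≡⟨ cong (λ b → if b then ⌊ dist² X Y <? dist² Y Y ⌋ else ⌊ + 0 <? det X Y Y ⌋)
            (⌊⌋≡true (det X Y Y ≟ + 0) (det-repeat X Y)) ⟩
  ⌊ dist² X Y <? dist² Y Y ⌋
    ≡⟨ ⌊⌋≡false (dist² X Y <? dist² Y Y)
                (≤⇒≯ (subst (_≤ dist² X Y) (sym (dist²-self Y)) (dist²-nonNeg X Y))) ⟩
  false ∎
  where open ≡-Reasoning

f≡true⇒≢ : ∀ X Y Z → f X Y Z ≡ true → Z ≢ Y
f≡true⇒≢ X Y _ fXYY refl = contradiction (trans (sym fXYY) (f-at-head X Y)) λ ()


lin-normal : ∀ X Y P →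
  lin (x₂ Y - x₂ X) (x₁ X - x₁ Y) P ≡ (x₁ X * x₂ Y - x₂ X * x₁ Y) - det X Y P
lin-normal (x₁ , x₂) (y₁ , y₂) (p₁ , p₂) = identity x₁ x₂ y₁ y₂ p₁ p₂
  where
  identity : ∀ x₁ x₂ y₁ y₂ p₁ p₂ →
    (y₂ - x₂) * p₁ + (x₁ - y₁) * p₂
    ≡ (x₁ * y₂ - x₂ * y₁) - ((y₁ * p₂ - y₂ * p₁) - (x₁ * p₂ - x₂ * p₁) + (x₁ * y₂ - x₂ * y₁))
  identity = solve-∀

left-of⇒edge : X ≢ Y → All (λ P → P ≡ X ⊎ P ≡ Y ⊎ CCW X Y P) S → IsEdge S X Y
left-of⇒edge {X} {Y} X≢Y leftOf =
  X≢Y , a , b , c , on-line X-on-line , on-line (det-repeat X Y) , All.map supported leftOf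
  where
  a b c : ℤ
  a = x₂ Y - x₂ X
  b = x₁ X - x₁ Y
  c = x₁ X * x₂ Y - x₂ X * x₁ Y

  X-on-line : det X Y X ≡ + 0
  X-on-line = trans (det-rotate X Y X) (det-repeat Y X)

  on-line : ∀ {P} → det X Y P ≡ + 0 → lin a b P ≡ c
  on-line {P} d≡0 = trans (lin-normal X Y P) (trans (cong (_-_ c) d≡0) (+-identityʳ c))

  supported : ∀ {P} → P ≡ X ⊎ P ≡ Y ⊎ CCW X Y P →
    lin a b P ≤ c × (lin a b P ≡ c → P ≡ X ⊎ P ≡ Y)
  supported (inj₁ refl) = ≤-reflexive (on-line X-on-line) , λ _ → inj₁ refl
  supported (inj₂ (inj₁ refl)) = ≤-reflexive (on-line (det-repeat X Y)) , λ _ → inj₂ refl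
  supported {P} (inj₂ (inj₂ 0<d)) = <⇒≤ below , λ onLine → contradiction onLine (<⇒≢ below)
    where
    below : lin a b P < c
    below = subst (_< c) (sym (lin-normal X Y P)) (i-j<i c 0<d)


ccw-rotate : ∀ X Y Z → CCW X Y Z → CCW Y Z X
ccw-rotate X Y Z = subst (+ 0 <_) (det-rotate X Y Z)

module _ {A B C D : Point} where

  private
    corners : List Point
    corners = A ∷ B ∷ C ∷ D ∷ []

  ccwQuad⇒edges : CCWQuad A B C D →
    IsEdge corners A B × IsEdge corners B C × IsEdge corners C D × IsEdge corners D A
  ccwQuad⇒edges (abc , bcd , cda , dab) =
    left-of⇒edge (ccw⇒≢ A B C abc) (on₁ ∷ on₂ ∷ left abc ∷ left abd ∷ []) ,
    left-of⇒edge (ccw⇒≢ B C D bcd) (left bca ∷ on₁ ∷ on₂ ∷ left bcd ∷ []) ,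
    left-of⇒edge (ccw⇒≢ C D A cda) (left cda ∷ left cdb ∷ on₁ ∷ on₂ ∷ []) ,
    left-of⇒edge (ccw⇒≢ D A B dab) (on₂ ∷ left dab ∷ left dac ∷ on₁ ∷ [])
    where
    abd : CCW A B D
    abd = ccw-rotate D A B dab
    bca : CCW B C A
    bca = ccw-rotate A B C abc
    cdb : CCW C D B
    cdb = ccw-rotate B C D bcd
    dac : CCW D A C
    dac = ccw-rotate C D A cda

    on₁ : ∀ {P Q R} → P ≡ P ⊎ P ≡ Q ⊎ R
    on₁ = inj₁ refl
    on₂ : ∀ {P Q R} → Q ≡ P ⊎ Q ≡ Q ⊎ R
    on₂ = inj₂ (inj₁ refl)
    left : ∀ {P Q R Z} → R → Z ≡ P ⊎ Z ≡ Q ⊎ R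
    left = inj₂ ∘ inj₂

  ccwQuad⇒proper : PrimeSeg A B → PrimeSeg C D → CCWQuad A B C D → Proper A B C D
  ccwQuad⇒proper AB-prime CD-prime (abc , bcd , cda , dab) =
    AB-prime , CD-prime ,
    ccw⇒f≡true C D A cda , ccw⇒f≡true C D B (ccw-rotate B C D bcd) ,
    ccw⇒f≡true A B C abc , ccw⇒f≡true A B D (ccw-rotate D A B dab)

  proper⇒ccwQuad : ConvexPosition A B C D → Proper A B C D → CCWQuad A B C D
  proper⇒ccwQuad (vA , vB , vC , vD) ((A≢B , _) , (C≢D , _) , fCDA , fCDB , fABC , fABD) =
    abc , ccw-rotate D B C (ccw-rotate C D B cdb) , cda , ccw-rotate B D A (ccw-rotate A B D abd)
    where
    noncollinear : ∀ {P Q R} → P ∈ corners → Q ∈ corners → R ∈ corners →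
      P ≢ Q → Q ≢ R → P ≢ R → det P Q R ≢ + 0
    noncollinear = convex⇒noncollinear (vA ∷ vB ∷ vC ∷ vD ∷ [])

    A∈ : A ∈ corners
    A∈ = here refl
    B∈ : B ∈ corners
    B∈ = there (here refl)
    C∈ : C ∈ corners
    C∈ = there (there (here refl))
    D∈ : D ∈ corners
    D∈ = there (there (there (here refl)))

    B≢C : B ≢ C
    B≢C = ≢-sym (f≡true⇒≢ A B C fABC)
    B≢D : B ≢ D
    B≢D = ≢-sym (f≡true⇒≢ A B D fABD)
    A≢D : A ≢ D
    A≢D = f≡true⇒≢ C D A fCDA

    abd : CCW A B D
    abd = f≡true⇒ccw A B D (noncollinear A∈ B∈ D∈ A≢B B≢D A≢D) fABD

    -- For A = C, properness would put B left of AD and D left of AB.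
    A≢C : A ≢ C
    A≢C refl = contradiction (trans (sym fCDB) (ccw⇒reversed-f≡false A B D abd)) λ ()

    abc : CCW A B C
    abc = f≡true⇒ccw A B C (noncollinear A∈ B∈ C∈ A≢B B≢C A≢C) fABC
    cda : CCW C D A
    cda = f≡true⇒ccw C D A (noncollinear C∈ D∈ A∈ C≢D (≢-sym A≢D) (≢-sym A≢C)) fCDA
    cdb : CCW C D B
    cdb = f≡true⇒ccw C D B (noncollinear C∈ D∈ B∈ C≢D (≢-sym B≢D) (≢-sym B≢C)) fCDB

lemma3 : (m n : ℕ) (A B C D : Point) →
    InGrid m n A → InGrid m n B → InGrid m n C → InGrid m n D →
    PrimeSeg A B → PrimeSeg C D →
    ConvexPosition A B C D →
    Proper A B C D ⇔
      (IsEdge (A ∷ B ∷ C ∷ D ∷ []) A B × IsEdge (A ∷ B ∷ C ∷ D ∷ []) B C ×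
       IsEdge (A ∷ B ∷ C ∷ D ∷ []) C D × IsEdge (A ∷ B ∷ C ∷ D ∷ []) D A ×
       CCWQuad A B C D)
lemma3 _ _ A B C D _ _ _ _ AB-prime CD-prime convex = mk⇔
  (λ proper → let ccw = proper⇒ccwQuad convex proper
                  (AB , BC , CD , DA) = ccwQuad⇒edges ccw
              in AB , BC , CD , DA , ccw)
  (λ (_ , _ , _ , _ , ccw) → ccwQuad⇒proper AB-prime CD-prime ccw)
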